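{- For every $n \geq 1$, the map $\lambda$ defined on covering pairs $u \lessdot v$ of $(\mathsf{Tr}(n),\preccurlyeq)$ by $\lambda(u,v) := (i, u_i)$, where $i$ is the unique index with $u_i \neq v_i$, is an EL-labelling of $(\mathsf{Tr}(n),\preccurlyeq)$ with values in $\mathbb{Z}^2$ ordered lexicographically. Moreover, between any pair of comparable elements $u \preccurlyeq v$ of $\mathsf{Tr}(n)$ there is at most one $\lambda$-weakly decreasing saturated chain.
   Context: For $n\ge1$, $\mathsf{Tr}(n)$ is the set of words $u = u_1\cdots u_n$ over $\{0,1,2\}$ with $u_1 \neq 2$ and no indices $i<j$ with $u_i=0$, $u_j=1$, ordered componentwise ($u\preccurlyeq v$ iff $u_i\le v_i$ for all $i$). It is known (and may be assumed) that if $v$ covers $u$ in this poset then $u$ and $v$ differ in exactly one position, so $\lambda$ is well defined. A saturated chain from $x$ to $y$ is a sequence $x = x^{(1)} \lessdot x^{(2)} \lessdot \cdots \lessdot x^{(k)} = y$ of covering relations; its label word is $(\lambda(x^{(1)},x^{(2)}),\dots,\lambda(x^{(k-1)},x^{(k)}))$. The chain is $\lambda$-increasing if its label word is strictly increasing, $\lambda$-weakly decreasing if its label word is weakly decreasing (for the lexicographic order on $\mathbb{Z}^2$). One chain is $\lambda$-smaller than another if its label word is smaller in the lexicographic order on words induced by the order on labels. A map $\lambda$ from covering pairs of a bounded poset to a poset is an EL-labelling if for every $x \preccurlyeq y$ there is exactly one $\lambda$-increasing saturated chain from $x$ to $y$, and this chain is $\lambda$-smaller than every other saturated chain from $x$ to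 $y$. -}

module Defs where

open import Data.Nat using (ℕ; zero; suc; _<_; _≤_)
open import Data.Fin using (Fin; toℕ) renaming (zero to fz; suc to fs)
open import Data.Fin.Properties using (_≟_)
open import Data.Vec using (Vec; []; _∷_; lookup)
open import Data.List using (List; []; _∷_)
open import Data.List.Relation.Unary.Linked using (Linked)
open import Data.List.Relation.Binary.Lex.Strict using (Lex-<)
open import Data.Product using (_×_; _,_; Σ; ∃)
open import Data.Sum using (_⊎_)
open import Relation.Nullary using (¬_; yes; no)
open import Relation.Binary.PropositionalEquality using (_≡_; _≢_)

Letter : Set
Letter = Fin 3

Word : ℕ → Set
Word n = Vec Letter n

-- membership in Tr(n) (positions are Fin n; position fz is u_1)
record InTr {n : ℕ} (u : Word n) : Set where
  field
    firstNot2 : (i : Fin n) → toℕ i ≡ 0 → toℕ (lookup u i) ≢ 2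
    no01      : (i j : Fin n) → toℕ i < toℕ j →
                toℕ (lookup u i) ≡ 0 → toℕ (lookup u j) ≢ 1

_≼_ : {n : ℕ} → Word n → Word n → Set
u ≼ v = ∀ i → toℕ (lookup u i) ≤ toℕ (lookup v i)

_≺_ : {n : ℕ} → Word n → Word n → Set
u ≺ v = u ≼ v × u ≢ v

record _⋖_ {n : ℕ} (u v : Word n) : Set where
  field
    inTrˡ   : InTr u
    inTrʳ   : InTr v
    strict  : u ≺ v
    nothing : (w : Word n) → InTr w → u ≺ w → ¬ (w ≺ v)

Label : Set
Label = ℕ × ℕ

_<L_ : Label → Label → Set
(i , a) <L (j , b) = i < j ⊎ (i ≡ j × a < b)

_≤L_ : Label → Label → Set
x ≤L y = x <L y ⊎ x ≡ y

_≥L_ : Label → Label → Set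
x ≥L y = y ≤L x

-- λ(u,v) = (i, u_i) with i the (1-based) index where u and v differ.
-- Computed as the first differing index; on covering pairs this is the
-- unique differing index (known fact assumed in the paper).
lab : {n : ℕ} → Word n → Word n → Label
lab [] [] = (0 , 0)
lab (a ∷ u) (b ∷ v) with a ≟ b
... | yes _ with lab u v
...   | (i , c) = (suc i , c)
lab (a ∷ u) (b ∷ v) | no _ = (1 , toℕ a)

data SatChain {n : ℕ} : Word n → Word n → List (Word n) → Set where
  single : {x : Word n} → InTr x → SatChain x x (x ∷ [])
  step   : {x y z : Word n} {zs : List (Word n)} →
           x ⋖ y → SatChain y z zs → SatChain x z (x ∷ zs)

labelWord : {n : ℕ} → List (Word n) → List Label
labelWord (x ∷ y ∷ zs) = lab x y ∷ labelWord (y ∷ zs)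
labelWord _ = []

Increasing : List Label → Set
Increasing = Linked _<L_

WeaklyDecreasing : List Label → Set
WeaklyDecreasing = Linked _≥L_

_<W_ : List Label → List Label → Set
_<W_ = Lex-< _≡_ _<L_

IsELLabelling : ℕ → Set
IsELLabelling n =
  (x y : Word n) → InTr x → InTr y → x ≼ y →
    (Σ (List (Word n)) λ cs → SatChain x y cs × Increasing (labelWord cs)
       × ((ds : List (Word n)) → SatChain x y ds → ds ≢ cs →
            labelWord cs <W labelWord ds))
    × ((cs ds : List (Word n)) → SatChain x y cs → Increasing (labelWord cs) →
         SatChain x y ds → Increasing (labelWord ds) → cs ≡ ds)

AtMostOneWeaklyDecreasing : ℕ → Set
AtMostOneWeaklyDecreasing n =
  (x y : Word n) → InTr x → InTr y → x ≼ y →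
    (cs ds : List (Word n)) → SatChain x y cs → WeaklyDecreasing (labelWord cs) →
      SatChain x y ds → WeaklyDecreasing (labelWord ds) → cs ≡ ds

module Submission where

-- Every cover x ⋖ z raises a single letter of x ("z is a raise of x at d"),
-- and a cover is determined by that position.  For consecutive raises at d
-- and q, increasing labels force d ≤ q and weakly decreasing ones force q < d.
-- So an increasing chain from x to y starts at the FIRST position where x and
-- y differ, a weakly decreasing one at the LAST; the first step being
-- determined, induction on chains gives uniqueness of both kinds at once
-- (module FirstStepDetermined).  Any chain starts at a position where x and y
-- differ, so the increasing chain is lexicographically least.  Existence:
-- x ≺ y has a cover raising their first difference while staying below y
-- (raising 0 to 2 may have to pass through 1); iterating this, with the
-- letter distance to y decreasing, builds an increasing chain.

open import Defs
open import Data.Nat using (ℕ; suc; _<_; _≤_; _∸_; _+_; z≤n; s≤s; z<s)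
open import Data.Nat.Properties as ℕ
  using (≤-trans; ≤-antisym; <-irrefl; <-cmp; ≤-refl; <⇒≤; <-≤-trans;
         ≤-reflexive; ≤∧≢⇒<; <⇒≢; <⇒≱; n≮0; ∸-monoʳ-<; +-monoˡ-<; +-monoʳ-<)
open import Data.Nat.Induction using (<-wellFounded)
open import Data.Fin using (Fin; toℕ) renaming (zero to fz; suc to fs)
open import Data.Fin.Properties using (toℕ-injective; toℕ<n; any?) renaming (_≟_ to _≟F_)
import Data.Fin.Properties as Fin
open import Data.Vec using ([]; _∷_; lookup; _[_]≔_)
open import Data.Vec.Properties using (≡-dec; tabulate∘lookup; tabulate-cong; lookup∘update; lookup∘update′)
open import Data.List using (_∷_)
open import Data.List.Relation.Unary.Linked using (Linked; []; [-]; _∷_)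
import Data.List.Relation.Unary.Linked as Linked
open import Data.List.Relation.Binary.Lex.Core using (this; next)
open import Data.Product using (_×_; _,_; proj₁; proj₂; ∃)
open import Data.Sum using (inj₁; inj₂)
open import Data.Empty using (⊥; ⊥-elim)
open import Function using (_∘_)
open import Induction.WellFounded using (Acc; acc)
open import Relation.Nullary using (¬_; Dec; yes; no; contradiction)
open import Relation.Nullary.Decidable using (_×-dec_)
open import Relation.Binary.PropositionalEquality
  using (_≡_; _≢_; refl; sym; trans; cong; subst; subst₂)
open import Relation.Binary using (tri<; tri≈; tri>)

_!_ : ∀ {n} → Word n → Fin n → ℕ
u ! i = toℕ (lookup u i)

word-ext : ∀ {n} {u v : Word n} → (∀ i → u ! i ≡ v ! i) → u ≡ v
word-ext {u = u} {v} h =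
  trans (sym (tabulate∘lookup u))
        (trans (tabulate-cong (toℕ-injective ∘ h)) (tabulate∘lookup v))

agree-except : ∀ {n} {u v : Word n} d → (∀ i → i ≢ d → u ! i ≡ v ! i) →
               u ! d ≡ v ! d → u ≡ v
agree-except {u = u} {v} d off at = word-ext λ i → case i
  where
  case : ∀ i → u ! i ≡ v ! i
  case i with i ≟F d
  ... | yes refl = at
  ... | no i≢d = off i i≢d

≼-antisym : ∀ {n} {u v : Word n} → u ≼ v → v ≼ u → u ≡ v
≼-antisym p q = word-ext λ i → ≤-antisym (p i) (q i)

<⇒≢F : ∀ {n} {i d : Fin n} → toℕ i < toℕ d → i ≢ d
<⇒≢F i<d refl = <-irrefl refl i<d

>⇒≢F : ∀ {n} {i d : Fin n} → toℕ d < toℕ i → i ≢ d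
>⇒≢F d<i refl = <-irrefl refl d<i

update-here : ∀ {n} (x : Word n) d a → (x [ d ]≔ a) ! d ≡ toℕ a
update-here x d a = cong toℕ (lookup∘update d x a)

update-elsewhere : ∀ {n} (x : Word n) {i d} a → i ≢ d → (x [ d ]≔ a) ! i ≡ x ! i
update-elsewhere x a i≢d = cong toℕ (lookup∘update′ i≢d x a)

update-≼ : ∀ {n} {x y : Word n} {d a} → x ≼ y → toℕ a ≤ y ! d → (x [ d ]≔ a) ≼ y
update-≼ {x = x} {d = d} {a} x≼y a≤y i with i ≟F d
... | yes refl = ≤-trans (≤-reflexive (update-here x d a)) a≤y
... | no i≢d = ≤-trans (≤-reflexive (update-elsewhere x a i≢d)) (x≼y i)

update-InTr : ∀ {n} {x : Word n} {d a} → InTr x → x ! d < toℕ a →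
              (toℕ d ≡ 0 → toℕ a ≢ 2) →
              (∀ i → toℕ i < toℕ d → x ! i ≡ 0 → toℕ a ≢ 1) → InTr (x [ d ]≔ a)
update-InTr {x = x} {d} {a} x∈Tr x<a not2 not1 =
  record { firstNot2 = firstNot2 ; no01 = no01 }
  where
  x′ = x [ d ]≔ a
  firstNot2 : ∀ i → toℕ i ≡ 0 → x′ ! i ≢ 2
  firstNot2 i i≡0 with i ≟F d
  ... | yes refl = not2 i≡0 ∘ trans (sym (update-here x d a))
  ... | no i≢d = InTr.firstNot2 x∈Tr i i≡0 ∘ trans (sym (update-elsewhere x a i≢d))
  no01 : ∀ i j → toℕ i < toℕ j → x′ ! i ≡ 0 → x′ ! j ≢ 1
  no01 i j i<j x′i≡0 with i ≟F d | j ≟F d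
  ... | yes refl | _ = contradiction (subst (x ! d <_) (trans (sym (update-here x d a)) x′i≡0) x<a) n≮0
  ... | no i≢d | yes refl =
    not1 i i<j (trans (sym (update-elsewhere x a i≢d)) x′i≡0) ∘ trans (sym (update-here x d a))
  ... | no i≢d | no j≢d =
    InTr.no01 x∈Tr i j i<j (trans (sym (update-elsewhere x a i≢d)) x′i≡0)
      ∘ trans (sym (update-elsewhere x a j≢d))

record Raise {n} (x z : Word n) (d : Fin n) : Set where
  field
    same : ∀ i → i ≢ d → z ! i ≡ x ! i
    grow : x ! d < z ! d
open Raise

raise-≺ : ∀ {n} {x z : Word n} {d} → Raise x z d → x ≺ z
raise-≺ {x = x} {z} {d} r = x≼z , λ { refl → <-irrefl refl (grow r) }
  where
  x≼z : x ≼ z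
  x≼z i with i ≟F d
  ... | yes refl = <⇒≤ (grow r)
  ... | no i≢d = ≤-reflexive (sym (same r i i≢d))

raise-update : ∀ {n} {x : Word n} {d a} → x ! d < toℕ a → Raise x (x [ d ]≔ a) d
raise-update {x = x} {d} {a} x<a = record
  { same = λ i → update-elsewhere x a
  ; grow = subst (x ! d <_) (sym (update-here x d a)) x<a }

raise-tail : ∀ {n} {a c} {x z : Word n} {d} → Raise (a ∷ x) (c ∷ z) (fs d) → Raise x z d
raise-tail r = record { same = λ i i≢d → same r (fs i) (i≢d ∘ Fin.suc-injective) ; grow = grow r }

raises-ordered : ∀ {n} {x z z′ : Word n} {d} → Raise x z d → Raise x z′ d →
                 z ! d < z′ ! d → z ≺ z′
raises-ordered {z = z} {z′} {d} r r′ z<z′ = z≼z′ , λ { refl → <-irrefl refl z<z′ }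
  where
  z≼z′ : z ≼ z′
  z≼z′ i with i ≟F d
  ... | yes refl = <⇒≤ z<z′
  ... | no i≢d = ≤-reflexive (trans (same r i i≢d) (sym (same r′ i i≢d)))

raise-between : ∀ {n} {x z w : Word n} {d} → Raise x z d → x ≼ w → w ≼ z →
                ∀ i → i ≢ d → w ! i ≡ x ! i
raise-between r x≼w w≼z i i≢d =
  ≤-antisym (≤-trans (w≼z i) (≤-reflexive (same r i i≢d))) (x≼w i)

FirstDiff : ∀ {n} → Word n → Word n → Fin n → Set
FirstDiff x y d = (∀ i → toℕ i < toℕ d → x ! i ≡ y ! i) × x ! d ≢ y ! d

LastDiff : ∀ {n} → Word n → Word n → Fin n → Set
LastDiff x y d = (∀ i → toℕ d < toℕ i → x ! i ≡ y ! i) × x ! d ≢ y ! d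

firstDiff-unique : ∀ {n} {x y : Word n} {d d′} → FirstDiff x y d → FirstDiff x y d′ → d ≡ d′
firstDiff-unique {d = d} {d′} (agree , differ) (agree′ , differ′) with <-cmp (toℕ d) (toℕ d′)
... | tri< d<d′ _ _ = ⊥-elim (differ (agree′ d d<d′))
... | tri≈ _ d≡d′ _ = toℕ-injective d≡d′
... | tri> _ _ d′<d = ⊥-elim (differ′ (agree d′ d′<d))

lastDiff-unique : ∀ {n} {x y : Word n} {d d′} → LastDiff x y d → LastDiff x y d′ → d ≡ d′
lastDiff-unique {d = d} {d′} (agree , differ) (agree′ , differ′) with <-cmp (toℕ d) (toℕ d′)
... | tri< d<d′ _ _ = ⊥-elim (differ′ (agree d′ d<d′))
... | tri≈ _ d≡d′ _ = toℕ-injective d≡d′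
... | tri> _ _ d′<d = ⊥-elim (differ (agree′ d d′<d))

firstDiff : ∀ {n} (x y : Word n) → x ≢ y → ∃ (FirstDiff x y)
firstDiff [] [] x≢y = ⊥-elim (x≢y refl)
firstDiff (a ∷ x) (b ∷ y) x≢y with a ≟F b
... | no a≢b = fz , (λ _ ()) , a≢b ∘ toℕ-injective
... | yes refl with firstDiff x y (x≢y ∘ cong (a ∷_))
...   | d , agree , differ = fs d , agree′ , differ
  where
  agree′ : ∀ i → toℕ i < toℕ (fs d) → (a ∷ x) ! i ≡ (a ∷ y) ! i
  agree′ fz _ = refl
  agree′ (fs i) (s≤s i<d) = agree i i<d

raise-firstDiff : ∀ {n} {x z : Word n} {d} → Raise x z d → FirstDiff x z d
raise-firstDiff r = (λ i i<d → sym (same r i (<⇒≢F i<d))) , <⇒≢ (grow r)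

raise-lastDiff : ∀ {n} {x z : Word n} {d} → Raise x z d → LastDiff x z d
raise-lastDiff r = (λ i d<i → sym (same r i (>⇒≢F d<i))) , <⇒≢ (grow r)

lab-firstDiff : ∀ {n} (x z : Word n) d → FirstDiff x z d → lab x z ≡ (suc (toℕ d) , x ! d)
lab-firstDiff (a ∷ x) (b ∷ z) fz (_ , differ) with a ≟F b
... | yes a≡b = ⊥-elim (differ (cong toℕ a≡b))
... | no _ = refl
lab-firstDiff (a ∷ x) (b ∷ z) (fs d) (agree , differ) with a ≟F b
... | no a≢b = ⊥-elim (a≢b (toℕ-injective (agree fz z<s)))
... | yes _ rewrite lab-firstDiff x z d ((λ i i<d → agree (fs i) (s≤s i<d)) , differ) = refl

lab-raise : ∀ {n} {x z : Word n} {d} → Raise x z d → lab x z ≡ (suc (toℕ d) , x ! d)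
lab-raise {x = x} {z} {d} r = lab-firstDiff x z d (raise-firstDiff r)

-- Every cover raises a single letter: raising x at its first difference with z
-- gives an element of Tr(n) strictly between x and z, unless it is z itself.
cover⇒raise : ∀ {n} {x z : Word n} → x ⋖ z → ∃ (Raise x z)
cover⇒raise {x = x} {z} x⋖z with firstDiff x z (proj₂ (_⋖_.strict x⋖z))
... | d , agree , differ = d , subst (λ w → Raise x w d) w≡z x⇑w
  where
  open _⋖_ x⋖z
  x≼z : x ≼ z
  x≼z = proj₁ strict
  w : Word _
  w = x [ d ]≔ lookup z d
  x⇑w : Raise x w d
  x⇑w = raise-update (≤∧≢⇒< (x≼z d) differ)
  w∈Tr : InTr w
  w∈Tr = update-InTr inTrˡ (≤∧≢⇒< (x≼z d) differ) (InTr.firstNot2 inTrʳ d)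
           λ i i<d xi≡0 → InTr.no01 inTrʳ i d i<d (trans (sym (agree i i<d)) xi≡0)
  w≡z : w ≡ z
  w≡z with ≡-dec _≟F_ w z
  ... | yes w≡z = w≡z
  ... | no w≢z = ⊥-elim (nothing w w∈Tr (raise-≺ x⇑w) (update-≼ {x = x} {z} x≼z ≤-refl , w≢z))

covers-incomparable : ∀ {n} {x z z′ : Word n} → x ⋖ z → x ⋖ z′ → ¬ (z ≺ z′)
covers-incomparable x⋖z x⋖z′ = _⋖_.nothing x⋖z′ _ (_⋖_.inTrʳ x⋖z) (_⋖_.strict x⋖z)

cover-determined : ∀ {n} {x z z′ : Word n} {d} → x ⋖ z → x ⋖ z′ →
                   Raise x z d → Raise x z′ d → z ≡ z′
cover-determined {z = z} {z′} {d} x⋖z x⋖z′ r r′ with <-cmp (z ! d) (z′ ! d)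
... | tri< z<z′ _ _ = ⊥-elim (covers-incomparable x⋖z x⋖z′ (raises-ordered r r′ z<z′))
... | tri> _ _ z′<z = ⊥-elim (covers-incomparable x⋖z′ x⋖z (raises-ordered r′ r z′<z))
... | tri≈ _ z≡z′ _ = agree-except d (λ i i≢d → trans (same r i i≢d) (sym (same r′ i i≢d))) z≡z′

EarlierZero : ∀ {n} → Word n → Fin n → Set
EarlierZero x d = ∃ λ i → toℕ i < toℕ d × x ! i ≡ 0

earlierZero? : ∀ {n} (x : Word n) d → Dec (EarlierZero x d)
earlierZero? x d = any? λ i → (toℕ i ℕ.<? toℕ d) ×-dec (x ! i ℕ.≟ 0)

letters-0<1<2 : ∀ {a b c : ℕ} → a < b → b < c → c ≤ 2 → a ≡ 0 × b ≡ 1 × c ≡ 2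
letters-0<1<2 (s≤s z≤n) (s≤s (s≤s z≤n)) (s≤s (s≤s z≤n)) = refl , refl , refl

-- A raise is a cover unless it jumps from 0 to 2 with no 0 before it: a word
-- strictly in between agrees with x off d and has letter 1 at d, so an earlier
-- 0 of x would be followed by that 1.
raise⇒cover : ∀ {n} {x z : Word n} {d} → InTr x → InTr z → Raise x z d →
              (x ! d ≡ 0 → z ! d ≡ 2 → EarlierZero x d) → x ⋖ z
raise⇒cover {x = x} {z} {d} x∈Tr z∈Tr r jump = record
  { inTrˡ = x∈Tr ; inTrʳ = z∈Tr ; strict = raise-≺ r ; nothing = nothing }
  where
  nothing : (w : Word _) → InTr w → x ≺ w → ¬ (w ≺ z)
  nothing w w∈Tr (x≼w , x≢w) (w≼z , w≢z) = at-d (x ! d ℕ.≟ w ! d) (w ! d ℕ.≟ z ! d)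
    where
    w≗x : ∀ i → i ≢ d → w ! i ≡ x ! i
    w≗x = raise-between {w = w} r x≼w w≼z
    z≗x : ∀ i → i ≢ d → z ! i ≡ x ! i
    z≗x = same r
    at-d : Dec (x ! d ≡ w ! d) → Dec (w ! d ≡ z ! d) → ⊥
    at-d (yes x≡w) _ = x≢w (agree-except d (λ i → sym ∘ w≗x i) x≡w)
    at-d _ (yes w≡z) = w≢z (agree-except d (λ i i≢d → trans (w≗x i i≢d) (sym (z≗x i i≢d))) w≡z)
    at-d (no x≢w) (no w≢z′)
      with letters-0<1<2 (≤∧≢⇒< (x≼w d) x≢w) (≤∧≢⇒< (w≼z d) w≢z′) (ℕ.≤-pred (toℕ<n (lookup z d)))
    ... | x≡0 , w≡1 , z≡2 with jump x≡0 z≡2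
    ... | i , i<d , xi≡0 = InTr.no01 w∈Tr i d i<d (trans (w≗x i (<⇒≢F i<d)) xi≡0) w≡1

raise-below : ∀ {n} {x y : Word n} {d} a → InTr x → x ≼ y → x ! d < toℕ a → toℕ a ≤ y ! d →
              InTr (x [ d ]≔ a) → (x ! d ≡ 0 → toℕ a ≡ 2 → EarlierZero x d) →
              ∃ λ z → x ⋖ z × Raise x z d × z ≼ y
raise-below {x = x} {y} {d} a x∈Tr x≼y x<a a≤y x′∈Tr jump =
  x [ d ]≔ a ,
  raise⇒cover x∈Tr x′∈Tr (raise-update x<a) (λ x≡0 → jump x≡0 ∘ trans (sym (update-here x d a))) ,
  raise-update x<a ,
  update-≼ {x = x} {y} x≼y a≤y

-- If x ≼ y in Tr(n) and d is their first difference, some cover of x raises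
-- position d and stays below y: raise x_d to y_d, or to 1 when that would be
-- an illegal jump from 0 to 2.
cover-towards : ∀ {n} {x y : Word n} {d} → InTr x → InTr y → x ≼ y → FirstDiff x y d →
                ∃ λ z → x ⋖ z × Raise x z d × z ≼ y
cover-towards {x = x} {y} {d} x∈Tr y∈Tr x≼y (agree , differ) =
  by-cases (earlierZero? x d) (x ! d ℕ.≟ 0) (y ! d ℕ.≟ 2)
  where
  x<y : x ! d < y ! d
  x<y = ≤∧≢⇒< (x≼y d) differ
  to-y : (x ! d ≡ 0 → y ! d ≡ 2 → EarlierZero x d) → ∃ λ z → x ⋖ z × Raise x z d × z ≼ y
  to-y = raise-below {y = y} (lookup y d) x∈Tr x≼y x<y ≤-refl
           (update-InTr x∈Tr x<y (InTr.firstNot2 y∈Tr d)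
              λ i i<d xi≡0 → InTr.no01 y∈Tr i d i<d (trans (sym (agree i i<d)) xi≡0))
  to-one : ¬ EarlierZero x d → x ! d ≡ 0 → y ! d ≡ 2 → ∃ λ z → x ⋖ z × Raise x z d × z ≼ y
  to-one none x≡0 y≡2 = raise-below {y = y} (fs fz) x∈Tr x≼y x<1 (subst (1 ≤_) (sym y≡2) (s≤s z≤n))
    (update-InTr x∈Tr x<1 (λ _ ()) λ i i<d xi≡0 _ → none (i , i<d , xi≡0)) λ _ ()
    where
    x<1 : x ! d < 1
    x<1 = subst (_< 1) (sym x≡0) z<s
  by-cases : Dec (EarlierZero x d) → Dec (x ! d ≡ 0) → Dec (y ! d ≡ 2) →
             ∃ λ z → x ⋖ z × Raise x z d × z ≼ y
  by-cases (no none) (yes x≡0) (yes y≡2) = to-one none x≡0 y≡2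
  by-cases (yes earlier) _ _ = to-y λ _ _ → earlier
  by-cases _ (no x≢0) _ = to-y λ x≡0 _ → contradiction x≡0 x≢0
  by-cases _ _ (no y≢2) = to-y λ _ y≡2 → contradiction y≡2 y≢2

chain-≼ : ∀ {n} {x y : Word n} {cs} → SatChain x y cs → x ≼ y
chain-≼ (single _) i = ≤-refl
chain-≼ (step x⋖z chain) i = ≤-trans (proj₁ (_⋖_.strict x⋖z) i) (chain-≼ chain i)

no-return : ∀ {n} {x z : Word n} {zs} → x ⋖ z → SatChain z x zs → ⊥
no-return x⋖z chain = proj₂ (_⋖_.strict x⋖z) (≼-antisym (proj₁ (_⋖_.strict x⋖z)) (chain-≼ chain))

grows-at : ∀ {n} {x z y : Word n} {zs} {d} → Raise x z d → SatChain z y zs → x ! d < y ! d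
grows-at {d = d} r chain = <-≤-trans (grow r) (chain-≼ chain d)

labelWord-step : ∀ {n} {x z y : Word n} {zs} → SatChain z y zs →
                 labelWord (x ∷ zs) ≡ lab x z ∷ labelWord zs
labelWord-step (single _) = refl
labelWord-step (step _ _) = refl

head-labels : ∀ {n} {R : Label → Label → Set} {x z w y : Word n} {ws} → SatChain w y ws →
              Linked R (labelWord (x ∷ z ∷ ws)) → R (lab x z) (lab z w)
head-labels (single _) (r ∷ _) = r
head-labels (step _ _) (r ∷ _) = r

tail-labels : ∀ {n} {R : Label → Label → Set} {x z y : Word n} {zs} → SatChain z y zs →
              Linked R (labelWord (x ∷ zs)) → Linked R (labelWord zs)
tail-labels (single _) = Linked.tail
tail-labels (step _ _) = Linked.tail

cons-labels : ∀ {n} {R : Label → Label → Set} {x z w y : Word n} {ws} → SatChain w y ws →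
              R (lab x z) (lab z w) → Linked R (labelWord (z ∷ ws)) → Linked R (labelWord (x ∷ z ∷ ws))
cons-labels (single _) r l = r ∷ l
cons-labels (step _ _) r l = r ∷ l

positions-increasing : ∀ {n} {x z w : Word n} {d q} → Raise x z d → Raise z w q →
                       toℕ d ≤ toℕ q → lab x z <L lab z w
positions-increasing r r′ d≤q with ℕ.m≤n⇒m<n∨m≡n d≤q
... | inj₁ d<q = subst₂ _<L_ (sym (lab-raise r)) (sym (lab-raise r′)) (inj₁ (s≤s d<q))
... | inj₂ d≡q with toℕ-injective d≡q
...   | refl = subst₂ _<L_ (sym (lab-raise r)) (sym (lab-raise r′)) (inj₂ (refl , grow r))

raise-not-lowered : ∀ {n} {x z : Word n} {d q} → Raise x z d → toℕ q ≡ toℕ d → ¬ (z ! q ≤ x ! d)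
raise-not-lowered r q≡d z≤x with toℕ-injective q≡d
... | refl = <⇒≱ (grow r) z≤x

-- Consecutive raises at d then q: an increasing pair of labels forces d ≤ q,
-- a weakly decreasing pair forces q < d (equal positions give increasing labels).
increasing-positions : ∀ {n} {x z w : Word n} {d q} → Raise x z d → Raise z w q →
                       lab x z <L lab z w → toℕ d ≤ toℕ q
increasing-positions r r′ lt with subst₂ _<L_ (lab-raise r) (lab-raise r′) lt
... | inj₁ (s≤s d<q) = <⇒≤ d<q
... | inj₂ (d≡q , _) = ≤-reflexive (ℕ.suc-injective d≡q)

decreasing-positions : ∀ {n} {x z w : Word n} {d q} → Raise x z d → Raise z w q →
                       lab x z ≥L lab z w → toℕ q < toℕ d
decreasing-positions r r′ ge with subst₂ _≤L_ (lab-raise r′) (lab-raise r) ge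
... | inj₁ (inj₁ (s≤s q<d)) = q<d
... | inj₁ (inj₂ (q≡d , z<x)) = ⊥-elim (raise-not-lowered r (ℕ.suc-injective q≡d) (<⇒≤ z<x))
... | inj₂ e = ⊥-elim (raise-not-lowered r (ℕ.suc-injective (cong proj₁ e)) (≤-reflexive (cong proj₂ e)))

increasing-first : ∀ {n} {x z y : Word n} {zs} {d} → Raise x z d → SatChain z y zs →
                   Increasing (labelWord (x ∷ zs)) → FirstDiff x y d
increasing-first r (single _) _ = raise-firstDiff r
increasing-first {x = x} {y = y} {d = d} r (step z⋖w chain) inc with cover⇒raise z⋖w
... | q , r′ = agree , <⇒≢ (grows-at r (step z⋖w chain))
  where
  d≤q : toℕ d ≤ toℕ q
  d≤q = increasing-positions r r′ (head-labels {x = x} chain inc)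
  agree : ∀ i → toℕ i < toℕ d → x ! i ≡ y ! i
  agree i i<d = trans (sym (same r i (<⇒≢F i<d)))
                      (proj₁ (increasing-first r′ chain (Linked.tail inc)) i (<-≤-trans i<d d≤q))

decreasing-first : ∀ {n} {x z y : Word n} {zs} {d} → Raise x z d → SatChain z y zs →
                   WeaklyDecreasing (labelWord (x ∷ zs)) → LastDiff x y d
decreasing-first r (single _) _ = raise-lastDiff r
decreasing-first {x = x} {y = y} {d = d} r (step z⋖w chain) dec with cover⇒raise z⋖w
... | q , r′ = agree , <⇒≢ (grows-at r (step z⋖w chain))
  where
  q<d : toℕ q < toℕ d
  q<d = decreasing-positions r r′ (head-labels {x = x} chain dec)
  agree : ∀ i → toℕ d < toℕ i → x ! i ≡ y ! i
  agree i d<i = trans (sym (same r i (>⇒≢F d<i)))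
                      (proj₁ (decreasing-first r′ chain (Linked.tail dec)) i (ℕ.<-trans q<d d<i))

module FirstStepDetermined
  (R : Label → Label → Set)
  (Pos : ∀ {n} → Word n → Word n → Fin n → Set)
  (pos-unique : ∀ {n} {x y : Word n} {d d′} → Pos x y d → Pos x y d′ → d ≡ d′)
  (pos-first : ∀ {n} {x z y : Word n} {zs} {d} → Raise x z d → SatChain z y zs →
               Linked R (labelWord (x ∷ zs)) → Pos x y d)
  where

  chains-unique : ∀ {n} {x y : Word n} {cs ds} → SatChain x y cs → Linked R (labelWord cs) →
                  SatChain x y ds → Linked R (labelWord ds) → cs ≡ ds
  chains-unique (single _) _ (single _) _ = refl
  chains-unique (single _) _ (step x⋖z chain) _ = ⊥-elim (no-return x⋖z chain)
  chains-unique (step x⋖z chain) _ (single _) _ = ⊥-elim (no-return x⋖z chain)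
  chains-unique {x = x} {y} (step x⋖z chain) lc (step x⋖z′ chain′) ld
    with cover⇒raise x⋖z | cover⇒raise x⋖z′
  ... | d , r | d′ , r′ with pos-unique {x = x} {y} (pos-first r chain lc) (pos-first r′ chain′ ld)
  ... | refl with cover-determined x⋖z x⋖z′ r r′
  ... | refl = cong (x ∷_) (chains-unique chain (tail-labels {x = x} chain lc)
                                           chain′ (tail-labels {x = x} chain′ ld))

increasing-unique : ∀ {n} {x y : Word n} {cs ds} → SatChain x y cs → Increasing (labelWord cs) →
                    SatChain x y ds → Increasing (labelWord ds) → cs ≡ ds
increasing-unique = FirstStepDetermined.chains-unique _<L_ FirstDiff
  (λ {_} {x} {y} → firstDiff-unique {x = x} {y}) increasing-first

decreasing-unique : ∀ {n} {x y : Word n} {cs ds} → SatChain x y cs → WeaklyDecreasing (labelWord cs) →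
                    SatChain x y ds → WeaklyDecreasing (labelWord ds) → cs ≡ ds
decreasing-unique = FirstStepDetermined.chains-unique _≥L_ LastDiff
  (λ {_} {x} {y} → lastDiff-unique {x = x} {y}) decreasing-first

-- An increasing chain is lexicographically smaller than every other chain: any
-- chain starts at a position where x and y differ, so not before the first
-- difference, where the increasing chain starts.
increasing-least : ∀ {n} {x y : Word n} {cs ds} → SatChain x y cs → Increasing (labelWord cs) →
                   SatChain x y ds → ds ≢ cs → labelWord cs <W labelWord ds
increasing-least (single _) _ (single _) ds≢cs = ⊥-elim (ds≢cs refl)
increasing-least (single _) _ (step x⋖z chain) _ = ⊥-elim (no-return x⋖z chain)
increasing-least (step x⋖z chain) _ (single _) _ = ⊥-elim (no-return x⋖z chain)
increasing-least {x = x} (step x⋖z chain) inc (step x⋖z′ chain′) ds≢cs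
  with cover⇒raise x⋖z | cover⇒raise x⋖z′
... | d , r | d′ , r′ with <-cmp (toℕ d) (toℕ d′)
... | tri< d<d′ _ _ =
  subst₂ _<W_ (sym (labelWord-step chain)) (sym (labelWord-step chain′))
    (this (subst₂ _<L_ (sym (lab-raise r)) (sym (lab-raise r′)) (inj₁ (s≤s d<d′))))
... | tri> _ _ d′<d =
  ⊥-elim (<⇒≢ (grows-at r′ chain′) (proj₁ (increasing-first r chain inc) d′ d′<d))
... | tri≈ _ d≡d′ _ with toℕ-injective d≡d′
... | refl with cover-determined x⋖z x⋖z′ r r′
... | refl =
  subst₂ _<W_ (sym (labelWord-step chain)) (sym (labelWord-step chain′))
    (next refl (increasing-least chain (tail-labels {x = x} chain inc) chain′ (ds≢cs ∘ cong (x ∷_))))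

-- Prepending a cover at the first difference of x and y to an increasing chain
-- to y keeps it increasing: the next step cannot be before d, where the chain
-- already agrees with y.
prepend-increasing : ∀ {n} {x z y : Word n} {zs} {d} → FirstDiff x y d → Raise x z d →
                     SatChain z y zs → Increasing (labelWord zs) → Increasing (labelWord (x ∷ zs))
prepend-increasing _ _ (single _) _ = [-]
prepend-increasing {x = x} {d = d} (agree , _) r (step z⋖w chain) inc with cover⇒raise z⋖w
... | q , r′ = cons-labels {x = x} chain (positions-increasing r r′ d≤q) inc
  where
  d≤q : toℕ d ≤ toℕ q
  d≤q = ℕ.≮⇒≥ λ q<d → <⇒≢ (grows-at r′ chain) (trans (same r q (<⇒≢F q<d)) (agree q q<d))

dist : ∀ {n} → Word n → Word n → ℕ
dist [] [] = 0
dist (a ∷ x) (b ∷ y) = (toℕ b ∸ toℕ a) + dist x y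

dist-decreases : ∀ {n} (x z y : Word n) {d} → Raise x z d → z ≼ y → dist z y < dist x y
dist-decreases (a ∷ x) (c ∷ z) (b ∷ y) {fz} r z≼y
  rewrite word-ext {u = z} {x} (λ i → same r (fs i) λ ())
  = +-monoˡ-< (dist x y) (∸-monoʳ-< (grow r) (z≼y fz))
dist-decreases (a ∷ x) (c ∷ z) (b ∷ y) {fs d} r z≼y
  rewrite same r fz λ ()
  = +-monoʳ-< (toℕ b ∸ toℕ a) (dist-decreases x z y (raise-tail r) (z≼y ∘ fs))

increasing-exists : ∀ {n} {x y : Word n} → InTr x → InTr y → x ≼ y → Acc _<_ (dist x y) →
                    ∃ λ cs → SatChain x y cs × Increasing (labelWord cs)
increasing-exists {x = x} {y} x∈Tr y∈Tr x≼y (acc smaller) with ≡-dec _≟F_ x y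
... | yes refl = _ , single x∈Tr , []
... | no x≢y with firstDiff x y x≢y
... | d , fd with cover-towards x∈Tr y∈Tr x≼y fd
... | z , x⋖z , r , z≼y
  with increasing-exists (_⋖_.inTrʳ x⋖z) y∈Tr z≼y (smaller (dist-decreases x z y r z≼y))
... | cs , chain , inc = x ∷ cs , step x⋖z chain , prepend-increasing fd r chain inc

theorem2p1 : (n : ℕ) → 1 ≤ n → IsELLabelling n × AtMostOneWeaklyDecreasing n
theorem2p1 n _ = el-labelling , λ x y _ _ _ _ _ → decreasing-unique
  where
  el-labelling : IsELLabelling n
  el-labelling x y x∈Tr y∈Tr x≼y
    with increasing-exists x∈Tr y∈Tr x≼y (<-wellFounded (dist x y))
  ... | cs , chain , inc =
    (cs , chain , inc , λ _ chain′ → increasing-least chain inc chain′) ,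
    λ _ _ → increasing-unique
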